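{- Let $R$ be a finite unital ring, $U$ a subgroup of $R^\times$ with $-1\in U$, and $\Gamma(R,S)$ a $U$-unitary Cayley graph. Suppose $\Gamma(R,U)$ is connected, and $\Gamma(R,S)$ is both connected and anti-connected. Then the following are equivalent: (1) $\Gamma(R,S)$ is not prime; (2) there exists a two-sided ideal $I$ of $R$ with $I\neq 0$ and $I\neq R$ which is a homogeneous set in $\Gamma(R,S)$.
   Context: For $S\subseteq R$ with $0\notin S$, $S=-S$, the Cayley graph $\Gamma(R,S)$ has vertex set $R$, with $a,b$ adjacent iff $a-b\in S$; it is $U$-unitary if $USU=S$. A graph is anti-connected if its complement is connected. A subset $X$ of the vertex set of a graph $G$ is homogeneous if every vertex outside $X$ is adjacent to all or to none of the vertices of $X$; it is non-trivial if $2\le|X|<|V(G)|$. $G$ is prime if it has no non-trivial homogeneous set. -}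

module Defs where

open import Data.Nat using (ℕ; _≤_; _<_)
open import Data.Fin using (Fin)
open import Data.Fin.Subset using (Subset; _∈_; _∉_; ∣_∣)
open import Data.Product using (Σ; ∃; _×_; _,_)
open import Data.Sum using (_⊎_)
open import Relation.Nullary using (¬_)
open import Relation.Binary.PropositionalEquality using (_≡_; _≢_)
open import Relation.Binary.Construct.Closure.ReflexiveTransitive using (Star)
open import Algebra.Structures using (IsRing)

-- A finite unital ring, presented (up to isomorphism) on the carrier Fin n
-- with propositional equality.
record FinRing (n : ℕ) : Set where
  infixl 6 _+_ _-_
  infixl 7 _*_
  infix  8 -_
  field
    _+_ _*_ : Fin n → Fin n → Fin n
    -_      : Fin n → Fin n
    0# 1#   : Fin n
    isRing  : IsRing _≡_ _+_ _*_ -_ 0# 1#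
  _-_ : Fin n → Fin n → Fin n
  a - b = a + (- b)

Graph : ℕ → Set₁
Graph n = Fin n → Fin n → Set

Connected : ∀ {n} → Graph n → Set
Connected {n} G = (a b : Fin n) → Star G a b

Complement : ∀ {n} → Graph n → Graph n
Complement G a b = a ≢ b × ¬ G a b

AntiConnected : ∀ {n} → Graph n → Set
AntiConnected G = Connected (Complement G)

Homogeneous : ∀ {n} → Graph n → Subset n → Set
Homogeneous {n} G X =
  (v : Fin n) → v ∉ X →
  ((x : Fin n) → x ∈ X → G v x) ⊎ ((x : Fin n) → x ∈ X → ¬ G v x)

NonTrivial : ∀ {n} → Subset n → Set
NonTrivial {n} X = 2 ≤ ∣ X ∣ × ∣ X ∣ < n

Prime : ∀ {n} → Graph n → Set
Prime {n} G = ¬ (Σ (Subset n) λ X → NonTrivial X × Homogeneous G X)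

module _ {n : ℕ} (R : FinRing n) where
  open FinRing R

  Cayley : Subset n → Graph n
  Cayley S a b = (a - b) ∈ S

  IsConnectionSet : Subset n → Set
  IsConnectionSet S = 0# ∉ S × ((s : Fin n) → s ∈ S → (- s) ∈ S)

  IsUnit : Fin n → Set
  IsUnit u = ∃ λ v → (u * v ≡ 1#) × (v * u ≡ 1#)

  IsUnitSubgroup : Subset n → Set
  IsUnitSubgroup U =
    ((u : Fin n) → u ∈ U → IsUnit u) ×
    1# ∈ U ×
    ((u v : Fin n) → u ∈ U → v ∈ U → (u * v) ∈ U) ×
    ((u v : Fin n) → u ∈ U → u * v ≡ 1# → v * u ≡ 1# → v ∈ U)

  IsUnitary : Subset n → Subset n → Set
  IsUnitary U S =
    ((u s v : Fin n) → u ∈ U → s ∈ S → v ∈ U → (u * s * v) ∈ S) ×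
    ((t : Fin n) → t ∈ S →
       ∃ λ u → ∃ λ s → ∃ λ v → u ∈ U × s ∈ S × v ∈ U × t ≡ u * s * v)

  IsTwoSidedIdeal : Subset n → Set
  IsTwoSidedIdeal I =
    0# ∈ I ×
    ((x y : Fin n) → x ∈ I → y ∈ I → (x + y) ∈ I) ×
    ((x : Fin n) → x ∈ I → (- x) ∈ I) ×
    ((r x : Fin n) → x ∈ I → (r * x) ∈ I) ×
    ((r x : Fin n) → x ∈ I → (x * r) ∈ I)

  NonZeroSet : Subset n → Set
  NonZeroSet I = ∃ λ x → x ∈ I × x ≢ 0#

  ProperSet : Subset n → Set
  ProperSet I = ∃ λ x → x ∉ I

{-# OPTIONS --safe #-}
module Submission where

open import Defs
open import Data.Nat using (ℕ)
open import Data.Fin.Subset using (Subset; _∈_)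
open import Data.Product using (Σ; _×_)
open import Relation.Nullary using (¬_)
open import Function.Bundles using (_⇔_)

open import Data.Nat using (_<_; _≤?_; _<?_)
open import Data.Nat.Properties using (<⇒≱; ≤-trans; n≤1+n)
open import Data.Fin using (Fin)
open import Data.Fin.Subset using (_∉_; _⊆_; _∪_; ⁅_⁆; ⊤; ∣_∣) renaming (⊥ to ∅)
open import Data.Fin.Subset.Properties
  using (_∈?_; anySubset?; p⊆q⇒∣p∣≤∣q∣; p⊂q⇒∣p∣<∣q∣; x∈p∪q⁺; x∈p∪q⁻; ∈⊤; ⊆⊤; ∣⊤∣≡n; ∣⊥∣≡0;
         x∈⁅y⁆⇒x≡y; x≢y⇒x∉⁅y⁆; x∉⁅y⁆⇒x≢y; ∣⁅x⁆∣≡1)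
open import Data.Fin.Properties using (any?; all?; ¬∀⟶∃¬)
open import Data.Vec using (tabulate; lookup)
open import Data.Vec.Properties using (lookup∘tabulate; []=⇒lookup; lookup⇒[]=)
open import Data.List using (List; []; _∷_; allFin)
open import Data.List.Membership.Propositional using () renaming (_∈_ to _∈ₗ_)
open import Data.List.Membership.Propositional.Properties using (∈-allFin)
open import Data.List.Relation.Unary.Any using (here; there)
open import Data.Product using (∃; ∃₂; _,_; proj₁; proj₂)
open import Data.Sum using (inj₁; inj₂; [_,_]′)
open import Function.Base using (_∘_; id)
open import Function.Bundles using (mk⇔)
open import Function.Definitions using (StrictlySurjective)
open import Relation.Nullary using (Dec; yes; no; contradiction)
open import Relation.Nullary.Decidable using (¬?; _×-dec_; _⊎-dec_; _→-dec_; decidable-stable)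
open import Relation.Binary.Definitions using (Symmetric)
open import Relation.Binary.PropositionalEquality using (_≡_; _≢_; refl; sym; trans; cong; subst; module ≡-Reasoning)
open import Relation.Binary.Construct.Closure.ReflexiveTransitive using (Star; ε; _◅_)
open import Algebra.Bundles using (Ring)
import Algebra.Properties.Ring as RingProperties
import Algebra.Properties.AbelianGroup as AbelianGroupProperties

-- Since Γ(R,S) is connected and anti-connected, the union of two proper homogeneous
-- sets through 0 is again proper; hence a non-trivial homogeneous set, translated to
-- contain 0, lies in a greatest proper homogeneous set M through 0. Translations by
-- elements of M and multiplications by units of U are automorphisms of Γ(R,S) moving
-- 0 into M, so by maximality their preimages of M lie in M: M is an additive subgroup
-- with UM ∪ MU ⊆ M. As Γ(R,U) is connected, every r ∈ R is a sum of units (the steps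
-- of a walk from r to 0), so M is a two-sided ideal.

module _ {n : ℕ} where

  ∣p∣<∣q∣⇒∃∈q∉p : {p q : Subset n} → ∣ p ∣ < ∣ q ∣ → ∃ λ x → x ∈ q × x ∉ p
  ∣p∣<∣q∣⇒∃∈q∉p {p} {q} ∣p∣<∣q∣ =
    decidable-stable (any? λ x → x ∈? q ×-dec ¬? (x ∈? p)) λ ∄ →
      <⇒≱ ∣p∣<∣q∣ (p⊆q⇒∣p∣≤∣q∣ λ {x} x∈q → decidable-stable (x ∈? p) λ x∉p → ∄ (x , x∈q , x∉p))

  nonTrivial⁺ : {X : Subset n} {a b z : Fin n} → a ∈ X → b ∈ X → a ≢ b → z ∉ X → NonTrivial X
  nonTrivial⁺ {X} {a} {b} {z} a∈X b∈X a≢b z∉X =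
    subst (_< ∣ X ∣) (∣⁅x⁆∣≡1 a) (p⊂q⇒∣p∣<∣q∣ (⁅a⁆⊆X , b , b∈X , x≢y⇒x∉⁅y⁆ (a≢b ∘ sym))) ,
    subst (∣ X ∣ <_) (∣⊤∣≡n n) (p⊂q⇒∣p∣<∣q∣ (⊆⊤ , z , ∈⊤ , z∉X))
    where
    ⁅a⁆⊆X : ⁅ a ⁆ ⊆ X
    ⁅a⁆⊆X x∈⁅a⁆ = subst (_∈ X) (sym (x∈⁅y⁆⇒x≡y a x∈⁅a⁆)) a∈X

  nonTrivial⁻ : {X : Subset n} → NonTrivial X →
                (∃₂ λ a b → a ∈ X × b ∈ X × a ≢ b) × ∃ (_∉ X)
  nonTrivial⁻ {X} (2≤∣X∣ , ∣X∣<n)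
    with ∣p∣<∣q∣⇒∃∈q∉p {∅} (subst (_< ∣ X ∣) (sym (∣⊥∣≡0 n)) (≤-trans (n≤1+n 1) 2≤∣X∣))
  ... | a , a∈X , _ with ∣p∣<∣q∣⇒∃∈q∉p {⁅ a ⁆} (subst (_< ∣ X ∣) (sym (∣⁅x⁆∣≡1 a)) 2≤∣X∣)
  ...   | b , b∈X , b∉⁅a⁆ with ∣p∣<∣q∣⇒∃∈q∉p {X} {⊤} (subst (∣ X ∣ <_) (sym (∣⊤∣≡n n)) ∣X∣<n)
  ...     | z , _ , z∉X = (a , b , a∈X , b∈X , x∉⁅y⁆⇒x≢y b∉⁅a⁆ ∘ sym) , z , z∉X

  preimage : (Fin n → Fin n) → Subset n → Subset n
  preimage f X = tabulate (lookup X ∘ f)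

  ∈-preimage⁺ : ∀ {f X y} → f y ∈ X → y ∈ preimage f X
  ∈-preimage⁺ {f} {X} {y} fy∈X = lookup⇒[]= y _
    (trans (lookup∘tabulate (lookup X ∘ f) y) ([]=⇒lookup fy∈X))

  ∈-preimage⁻ : ∀ {f X y} → y ∈ preimage f X → f y ∈ X
  ∈-preimage⁻ {f} {X} {y} y∈f⁻¹X = lookup⇒[]= (f y) X
    (trans (sym (lookup∘tabulate (lookup X ∘ f) y)) ([]=⇒lookup y∈f⁻¹X))

  entering-edge : ∀ {E : Graph n} {X a b} → Star E a b → a ∉ X → b ∈ X →
                  ∃₂ λ x y → x ∉ X × y ∈ X × E x y
  entering-edge ε a∉X a∈X = contradiction a∈X a∉X
  entering-edge {X = X} (_◅_ {j = c} e walk) a∉X b∈X with c ∈? X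
  ... | yes c∈X = _ , _ , a∉X , c∈X , e
  ... | no  c∉X = entering-edge walk c∉X b∈X

  module _ {P : Subset n → Set} (P? : ∀ X → Dec (P X)) (∪-closed : ∀ {A B} → P A → P B → P (A ∪ B)) where

    private
      covering : ∀ {X} → P X → (vs : List (Fin n)) →
                 ∃ λ M → P M × (∀ {v H} → v ∈ₗ vs → P H → v ∈ H → v ∈ M)
      covering pX [] = _ , pX , λ ()
      covering pX (w ∷ vs) with covering pX vs | anySubset? (λ H → P? H ×-dec w ∈? H)
      ... | M , pM , covers | yes (H , pH , w∈H) = M ∪ H , ∪-closed pM pH , λ
        { (here refl)  _   _   → x∈p∪q⁺ (inj₂ w∈H)
        ; (there v∈vs) pH′ v∈H′ → x∈p∪q⁺ (inj₁ (covers v∈vs pH′ v∈H′)) }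
      ... | M , pM , covers | no ∄ = M , pM , λ
        { (here refl)  pH v∈H → contradiction (_ , pH , v∈H) ∄
        ; (there v∈vs) → covers v∈vs }

    ∪-closed⇒greatest : ∀ {X} → P X → ∃ λ M → P M × (∀ {H} → P H → H ⊆ M)
    ∪-closed⇒greatest pX with covering pX (allFin n)
    ... | M , pM , covers = M , pM , λ pH v∈H → covers (∈-allFin _) pH v∈H

record IsAutomorphism {n : ℕ} (G : Graph n) (ψ : Fin n → Fin n) : Set where
  field
    preserves  : ∀ {a b} → G a b → G (ψ a) (ψ b)
    reflects   : ∀ {a b} → G (ψ a) (ψ b) → G a b
    surjective : StrictlySurjective _≡_ ψ

module HomogeneousSets {n : ℕ} (G : Graph n) where

  homogeneous? : (∀ a b → Dec (G a b)) → ∀ X → Dec (Homogeneous G X)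
  homogeneous? G? X = all? λ v → ¬? (v ∈? X) →-dec
    (all? (λ x → x ∈? X →-dec G? v x) ⊎-dec all? (λ x → x ∈? X →-dec ¬? (G? v x)))

  ¬prime⇒nonTrivialHomogeneous : (∀ a b → Dec (G a b)) → ¬ Prime G →
                                  Σ (Subset n) λ X → NonTrivial X × Homogeneous G X
  ¬prime⇒nonTrivialHomogeneous G? = decidable-stable
    (anySubset? λ X → (2 ≤? ∣ X ∣ ×-dec ∣ X ∣ <? n) ×-dec homogeneous? G? X)

  ∪-homogeneous : ∀ {A B c} → Homogeneous G A → Homogeneous G B → c ∈ A → c ∈ B →
                  Homogeneous G (A ∪ B)
  ∪-homogeneous {A} {B} {c} hA hB c∈A c∈B v v∉A∪B
    with hA v (v∉A∪B ∘ x∈p∪q⁺ ∘ inj₁) | hB v (v∉A∪B ∘ x∈p∪q⁺ ∘ inj₂)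
  ... | inj₁ v~A | inj₁ v~B = inj₁ λ x x∈A∪B → [ v~A x , v~B x ]′ (x∈p∪q⁻ A B x∈A∪B)
  ... | inj₂ v≁A | inj₂ v≁B = inj₂ λ x x∈A∪B → [ v≁A x , v≁B x ]′ (x∈p∪q⁻ A B x∈A∪B)
  ... | inj₁ v~A | inj₂ v≁B = contradiction (v~A c c∈A) (v≁B c c∈B)
  ... | inj₂ v≁A | inj₁ v~B = contradiction (v~B c c∈B) (v≁A c c∈A)

  adjacent-outside : Connected G → ∀ {X x z} → Homogeneous G X → x ∈ X → z ∉ X →
                     ∃ λ y → y ∉ X × (∀ x → x ∈ X → G y x)
  adjacent-outside con hX x∈X z∉X with entering-edge (con _ _) z∉X x∈X
  ... | y , w , y∉X , w∈X , y~w with hX y y∉X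
  ...   | inj₁ y~X = y , y∉X , y~X
  ...   | inj₂ y≁X = contradiction y~w (y≁X w w∈X)

  nonadjacent-outside : AntiConnected G → ∀ {X x z} → Homogeneous G X → x ∈ X → z ∉ X →
                        ∃ λ y → y ∉ X × (∀ x → x ∈ X → ¬ G y x)
  nonadjacent-outside anticon hX x∈X z∉X with entering-edge (anticon _ _) z∉X x∈X
  ... | y , w , y∉X , w∈X , (_ , y≁w) with hX y y∉X
  ...   | inj₁ y~X = contradiction (y~X w w∈X) y≁w
  ...   | inj₂ y≁X = y , y∉X , y≁X

  ∪-proper : Symmetric G → Connected G → AntiConnected G → ∀ {A B} →
             Homogeneous G A → Homogeneous G B → ∃ (_∉ A) → ∃ (_∉ B) → ∃ (_∉ A ∪ B)
  ∪-proper G-sym con anticon {A} {B} hA hB (zA , zA∉A) (zB , zB∉B) =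
    ¬∀⟶∃¬ n (_∈ A ∪ B) (_∈? A ∪ B) A∪B-not-full
    where
    ∉A⇒∈B : (∀ x → x ∈ A ∪ B) → ∀ {x} → x ∉ A → x ∈ B
    ∉A⇒∈B full {x} x∉A = [ (λ x∈A → contradiction x∈A x∉A) , id ]′ (x∈p∪q⁻ A B (full x))

    ∉B⇒∈A : (∀ x → x ∈ A ∪ B) → ∀ {x} → x ∉ B → x ∈ A
    ∉B⇒∈A full {x} x∉B = [ id , (λ x∈B → contradiction x∈B x∉B) ]′ (x∈p∪q⁻ A B (full x))

    -- zB lies in A and sees all or none of B ⊇ ∁ A; a vertex outside A seeing
    -- the opposite way all of A then contradicts symmetry at zB.
    A∪B-not-full : ¬ (∀ x → x ∈ A ∪ B)
    A∪B-not-full full with hB zB zB∉B | ∉B⇒∈A full zB∉B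
    ... | inj₁ zB~B | zB∈A = let y , y∉A , y≁A = nonadjacent-outside anticon hA zB∈A zA∉A in
                             y≁A zB zB∈A (G-sym (zB~B y (∉A⇒∈B full y∉A)))
    ... | inj₂ zB≁B | zB∈A = let y , y∉A , y~A = adjacent-outside con hA zB∈A zA∉A in
                             zB≁B y (∉A⇒∈B full y∉A) (G-sym (y~A zB zB∈A))

  ProperHomogeneousThrough : Fin n → Subset n → Set
  ProperHomogeneousThrough c X = c ∈ X × ∃ (_∉ X) × Homogeneous G X

  properHomogeneousThrough? : (∀ a b → Dec (G a b)) → ∀ c X → Dec (ProperHomogeneousThrough c X)
  properHomogeneousThrough? G? c X = c ∈? X ×-dec any? (λ x → ¬? (x ∈? X)) ×-dec homogeneous? G? X

  ∪-properHomogeneousThrough : Symmetric G → Connected G → AntiConnected G → ∀ {c A B} →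
    ProperHomogeneousThrough c A → ProperHomogeneousThrough c B → ProperHomogeneousThrough c (A ∪ B)
  ∪-properHomogeneousThrough G-sym con anticon (c∈A , A-proper , hA) (c∈B , B-proper , hB) =
    x∈p∪q⁺ (inj₁ c∈A) , ∪-proper G-sym con anticon hA hB A-proper B-proper , ∪-homogeneous hA hB c∈A c∈B

  preimage-properHomogeneousThrough : ∀ {ψ c X} → IsAutomorphism G ψ →
    ProperHomogeneousThrough (ψ c) X → ProperHomogeneousThrough c (preimage ψ X)
  preimage-properHomogeneousThrough {ψ} {X = X} ψ-auto (ψc∈X , (z , z∉X) , hX) =
    ∈-preimage⁺ ψc∈X , preimage-proper , preimage-homogeneous
    where
    open IsAutomorphism ψ-auto

    preimage-proper : ∃ (_∉ preimage ψ X)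
    preimage-proper = let y , ψy≡z = surjective z in
      y , λ y∈ψ⁻¹X → z∉X (subst (_∈ X) ψy≡z (∈-preimage⁻ y∈ψ⁻¹X))

    preimage-homogeneous : Homogeneous G (preimage ψ X)
    preimage-homogeneous v v∉ψ⁻¹X with hX (ψ v) (v∉ψ⁻¹X ∘ ∈-preimage⁺)
    ... | inj₁ ψv~X = inj₁ λ x x∈ψ⁻¹X → reflects (ψv~X (ψ x) (∈-preimage⁻ x∈ψ⁻¹X))
    ... | inj₂ ψv≁X = inj₂ λ x x∈ψ⁻¹X → ψv≁X (ψ x) (∈-preimage⁻ x∈ψ⁻¹X) ∘ preserves

  greatestProperHomogeneousThrough : (∀ a b → Dec (G a b)) → Symmetric G → Connected G → AntiConnected G →
    ∀ {c X} → ProperHomogeneousThrough c X →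
    ∃ λ M → ProperHomogeneousThrough c M × (∀ {H} → ProperHomogeneousThrough c H → H ⊆ M)
  greatestProperHomogeneousThrough G? G-sym con anticon {c} =
    ∪-closed⇒greatest (properHomogeneousThrough? G? c) (∪-properHomogeneousThrough G-sym con anticon)

  preimage⊆greatest : ∀ {c M ψ} → ProperHomogeneousThrough c M →
    (∀ {H} → ProperHomogeneousThrough c H → H ⊆ M) →
    IsAutomorphism G ψ → ψ c ∈ M → preimage ψ M ⊆ M
  preimage⊆greatest (_ , M-proper , hM) greatest ψ-auto ψc∈M =
    greatest (preimage-properHomogeneousThrough ψ-auto (ψc∈M , M-proper , hM))

module CayleyGraphs {n : ℕ} (R : FinRing n) where
  open FinRing R

  private
    ring : Ring _ _
    ring = record { isRing = isRing }

  open Ring ring using (+-abelianGroup; +-identityˡ; +-identityʳ; -‿inverseʳ; +-assoc;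
                        *-assoc; *-identityˡ; *-identityʳ; zeroˡ; zeroʳ; distribˡ; distribʳ)
  open RingProperties ring using (x[y-z]≈xy-xz; [y-z]x≈yx-zx; x+x≈x⇒x≈0)
  open AbelianGroupProperties +-abelianGroup
    using (⁻¹-anti-homo‿-; ⁻¹-anti-homo-∙; ⁻¹-involutive; ε⁻¹≈ε; //-rightDividesˡ; //-rightDividesʳ; x∙y⁻¹≈ε⇒x≈y)
  open ≡-Reasoning

  [x+z]-[y+z]≡x-y : ∀ x y z → (x + z) - (y + z) ≡ x - y
  [x+z]-[y+z]≡x-y x y z = begin
    (x + z) + - (y + z)   ≡⟨ cong ((x + z) +_) (⁻¹-anti-homo-∙ y z) ⟩
    (x + z) + (- z + - y) ≡⟨ +-assoc (x + z) (- z) (- y) ⟨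
    ((x + z) - z) - y     ≡⟨ cong (_- y) (//-rightDividesʳ z x) ⟩
    x - y                 ∎

  [x-y]+[y-z]≡x-z : ∀ x y z → (x - y) + (y - z) ≡ x - z
  [x-y]+[y-z]≡x-z x y z = begin
    (x - y) + (y + - z) ≡⟨ +-assoc (x - y) y (- z) ⟨
    ((x - y) + y) - z   ≡⟨ cong (_- z) (//-rightDividesˡ y x) ⟩
    x - z               ∎

  x-0≡x : ∀ x → x - 0# ≡ x
  x-0≡x x = trans (cong (x +_) ε⁻¹≈ε) (+-identityʳ x)

  x[yz]≡z : ∀ {x y} z → x * y ≡ 1# → x * (y * z) ≡ z
  x[yz]≡z {x} {y} z xy≡1 = begin
    x * (y * z) ≡⟨ *-assoc x y z ⟨
    (x * y) * z ≡⟨ cong (_* z) xy≡1 ⟩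
    1# * z      ≡⟨ *-identityˡ z ⟩
    z           ∎

  [zx]y≡z : ∀ {x y} z → x * y ≡ 1# → (z * x) * y ≡ z
  [zx]y≡z {x} {y} z xy≡1 = begin
    (z * x) * y ≡⟨ *-assoc z x y ⟩
    z * (x * y) ≡⟨ cong (z *_) xy≡1 ⟩
    z * 1#      ≡⟨ *-identityʳ z ⟩
    z           ∎

  module _ {S : Subset n} where

    cayley? : ∀ a b → Dec (Cayley R S a b)
    cayley? a b = a - b ∈? S

    cayley-symmetric : IsConnectionSet R S → Symmetric (Cayley R S)
    cayley-symmetric (_ , S-symmetric) {a} {b} a~b = subst (_∈ S) (⁻¹-anti-homo‿- a b) (S-symmetric _ a~b)

    +-isAutomorphism : ∀ m → IsAutomorphism (Cayley R S) (_+ m)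
    +-isAutomorphism m = record
      { preserves  = λ {a} {b} → subst (_∈ S) (sym ([x+z]-[y+z]≡x-y a b m))
      ; reflects   = λ {a} {b} → subst (_∈ S) ([x+z]-[y+z]≡x-y a b m)
      ; surjective = λ z → z - m , //-rightDividesˡ m z
      }

  inverse∈U : ∀ {U u} → IsUnitSubgroup R U → u ∈ U → ∃ λ v → v ∈ U × u * v ≡ 1# × v * u ≡ 1#
  inverse∈U {u = u} (unit , _ , _ , inverse-closed) u∈U = let v , uv≡1 , vu≡1 = unit u u∈U in
    v , inverse-closed u v u∈U uv≡1 vu≡1 , uv≡1 , vu≡1

  module _ {U S : Subset n} (U-subgroup : IsUnitSubgroup R U) (unitary : IsUnitary R U S) where

    U*S⊆S : ∀ {u s} → u ∈ U → s ∈ S → u * s ∈ S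
    U*S⊆S {u} {s} u∈U s∈S = subst (_∈ S) (*-identityʳ (u * s))
      (proj₁ unitary u s 1# u∈U s∈S (proj₁ (proj₂ U-subgroup)))

    S*U⊆S : ∀ {s u} → u ∈ U → s ∈ S → s * u ∈ S
    S*U⊆S {s} {u} u∈U s∈S = subst (_∈ S) (cong (_* u) (*-identityˡ s))
      (proj₁ unitary 1# s u (proj₁ (proj₂ U-subgroup)) s∈S u∈U)

    *-isAutomorphismˡ : ∀ {u} → u ∈ U → IsAutomorphism (Cayley R S) (u *_)
    *-isAutomorphismˡ {u} u∈U with inverse∈U U-subgroup u∈U
    ... | v , v∈U , uv≡1 , vu≡1 = record
      { preserves  = λ {a} {b} → subst (_∈ S) (x[y-z]≈xy-xz u a b) ∘ U*S⊆S u∈U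
      ; reflects   = λ {a} {b} → subst (_∈ S) (x[yz]≡z (a - b) vu≡1) ∘ U*S⊆S v∈U
                                  ∘ subst (_∈ S) (sym (x[y-z]≈xy-xz u a b))
      ; surjective = λ z → v * z , x[yz]≡z z uv≡1
      }

    *-isAutomorphismʳ : ∀ {u} → u ∈ U → IsAutomorphism (Cayley R S) (_* u)
    *-isAutomorphismʳ {u} u∈U with inverse∈U U-subgroup u∈U
    ... | v , v∈U , uv≡1 , vu≡1 = record
      { preserves  = λ {a} {b} → subst (_∈ S) ([y-z]x≈yx-zx u a b) ∘ S*U⊆S u∈U
      ; reflects   = λ {a} {b} → subst (_∈ S) ([zx]y≡z (a - b) uv≡1) ∘ S*U⊆S v∈U
                                  ∘ subst (_∈ S) (sym ([y-z]x≈yx-zx u a b))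
      ; surjective = λ z → z * v , [zx]y≡z z vu≡1
      }

  isTwoSidedIdeal-byUnits : ∀ {U I} → Connected (Cayley R U) → 0# ∈ I →
    (∀ {x y} → x ∈ I → y ∈ I → x - y ∈ I) →
    (∀ {u x} → u ∈ U → x ∈ I → u * x ∈ I) → (∀ {u x} → u ∈ U → x ∈ I → x * u ∈ I) →
    IsTwoSidedIdeal R I
  isTwoSidedIdeal-byUnits {U} {I} U-connected 0∈I sub-closed U*I⊆I I*U⊆I =
    0∈I , +-closed , -‿closed , *-closedˡ , *-closedʳ
    where
    -‿closed : ∀ x → x ∈ I → - x ∈ I
    -‿closed x x∈I = subst (_∈ I) (+-identityˡ (- x)) (sub-closed 0∈I x∈I)

    +-closed : ∀ x y → x ∈ I → y ∈ I → x + y ∈ I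
    +-closed x y x∈I y∈I = subst (_∈ I) (cong (x +_) (⁻¹-involutive y)) (sub-closed x∈I (-‿closed y y∈I))

    walk-closed : (f : Fin n → Fin n) → (∀ x y → f (x + y) ≡ f x + f y) → (∀ {u} → u ∈ U → f u ∈ I) →
                  ∀ {a b} → Star (Cayley R U) a b → f (a - b) ∈ I
    walk-closed f f-additive fU⊆I {a} ε = subst (_∈ I) (sym f[a-a]≡0) 0∈I
      where
      f[a-a]≡0 : f (a - a) ≡ 0#
      f[a-a]≡0 = begin
        f (a - a) ≡⟨ cong f (-‿inverseʳ a) ⟩
        f 0#      ≡⟨ x+x≈x⇒x≈0 (f 0#) (trans (sym (f-additive 0# 0#)) (cong f (+-identityʳ 0#))) ⟩
        0#        ∎
    walk-closed f f-additive fU⊆I (_◅_ {i = a} {j = c} {k = b} a-c∈U walk) =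
      subst (_∈ I) (trans (sym (f-additive (a - c) (c - b))) (cong f ([x-y]+[y-z]≡x-z a c b)))
        (+-closed _ _ (fU⊆I a-c∈U) (walk-closed f f-additive fU⊆I walk))

    *-closedˡ : ∀ r x → x ∈ I → r * x ∈ I
    *-closedˡ r x x∈I = subst (_∈ I) (cong (_* x) (x-0≡x r))
      (walk-closed (_* x) (distribʳ x) (λ u∈U → U*I⊆I u∈U x∈I) (U-connected r 0#))

    *-closedʳ : ∀ r x → x ∈ I → x * r ∈ I
    *-closedʳ r x x∈I = subst (_∈ I) (cong (x *_) (x-0≡x r))
      (walk-closed (x *_) (distribˡ x) (λ u∈U → I*U⊆I u∈U x∈I) (U-connected r 0#))

  homogeneousIdeal⇒¬prime : ∀ {S} →
    Σ (Subset n) (λ I → IsTwoSidedIdeal R I × NonZeroSet R I × ProperSet R I × Homogeneous (Cayley R S) I) →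
    ¬ Prime (Cayley R S)
  homogeneousIdeal⇒¬prime (I , (0∈I , _) , (x , x∈I , x≢0) , (z , z∉I) , hI) prime =
    prime (I , nonTrivial⁺ 0∈I x∈I (x≢0 ∘ sym) z∉I , hI)

  module _ {U S : Subset n} (U-subgroup : IsUnitSubgroup R U) (S-connection : IsConnectionSet R S)
           (unitary : IsUnitary R U S) (U-connected : Connected (Cayley R U))
           (connected : Connected (Cayley R S)) (anticonnected : AntiConnected (Cayley R S)) where

    open HomogeneousSets (Cayley R S)

    greatestProperHomogeneous⇒isTwoSidedIdeal : ∀ {M} → ProperHomogeneousThrough 0# M →
      (∀ {H} → ProperHomogeneousThrough 0# H → H ⊆ M) → IsTwoSidedIdeal R M
    greatestProperHomogeneous⇒isTwoSidedIdeal {M} M-pht@(0∈M , _) greatest =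
      isTwoSidedIdeal-byUnits U-connected 0∈M sub-closed U*M⊆M M*U⊆M
      where
      pullback : ∀ {ψ} → IsAutomorphism (Cayley R S) ψ → ψ 0# ∈ M → ∀ {y} → ψ y ∈ M → y ∈ M
      pullback ψ-auto ψ0∈M = preimage⊆greatest M-pht greatest ψ-auto ψ0∈M ∘ ∈-preimage⁺

      sub-closed : ∀ {x m} → x ∈ M → m ∈ M → x - m ∈ M
      sub-closed {x} {m} x∈M m∈M = pullback (+-isAutomorphism m)
        (subst (_∈ M) (sym (+-identityˡ m)) m∈M) (subst (_∈ M) (sym (//-rightDividesˡ m x)) x∈M)

      U*M⊆M : ∀ {u x} → u ∈ U → x ∈ M → u * x ∈ M
      U*M⊆M {u} {x} u∈U x∈M with inverse∈U U-subgroup u∈U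
      ... | v , v∈U , _ , vu≡1 = pullback (*-isAutomorphismˡ U-subgroup unitary v∈U)
        (subst (_∈ M) (sym (zeroʳ v)) 0∈M) (subst (_∈ M) (sym (x[yz]≡z x vu≡1)) x∈M)

      M*U⊆M : ∀ {u x} → u ∈ U → x ∈ M → x * u ∈ M
      M*U⊆M {u} {x} u∈U x∈M with inverse∈U U-subgroup u∈U
      ... | v , v∈U , uv≡1 , _ = pullback (*-isAutomorphismʳ U-subgroup unitary v∈U)
        (subst (_∈ M) (sym (zeroˡ v)) 0∈M) (subst (_∈ M) (sym ([zx]y≡z x uv≡1)) x∈M)

    translate-properHomogeneousThrough : ∀ {X a} → a ∈ X → ∃ (_∉ X) → Homogeneous (Cayley R S) X →
      ProperHomogeneousThrough 0# (preimage (_+ a) X)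
    translate-properHomogeneousThrough {X} {a} a∈X X-proper hX = preimage-properHomogeneousThrough
      (+-isAutomorphism a) (subst (_∈ X) (sym (+-identityˡ a)) a∈X , X-proper , hX)

    ¬prime⇒homogeneousIdeal : ¬ Prime (Cayley R S) →
      Σ (Subset n) λ I → IsTwoSidedIdeal R I × NonZeroSet R I × ProperSet R I × Homogeneous (Cayley R S) I
    ¬prime⇒homogeneousIdeal ¬prime with ¬prime⇒nonTrivialHomogeneous cayley? ¬prime
    ... | X , X-nonTrivial , hX with nonTrivial⁻ X-nonTrivial
    ... | (a , b , a∈X , b∈X , a≢b) , X-proper with translate-properHomogeneousThrough a∈X X-proper hX
    ... | X-a-pht with greatestProperHomogeneousThrough cayley? (cayley-symmetric S-connection)
                         connected anticonnected X-a-pht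
    ... | M , M-pht@(_ , M-proper , hM) , greatest =
      M , greatestProperHomogeneous⇒isTwoSidedIdeal M-pht greatest ,
      (b - a , b-a∈M , a≢b ∘ sym ∘ x∙y⁻¹≈ε⇒x≈y b a) , M-proper , hM
      where
      b-a∈M : b - a ∈ M
      b-a∈M = greatest X-a-pht (∈-preimage⁺ (subst (_∈ X) (sym (//-rightDividesˡ a b)) b∈X))

-- The hypothesis -1 ∈ U only makes Γ(R,U) undirected in the paper; connectivity
-- here is by directed walks, which is all the argument uses.
mainTheorem6 : (n : ℕ) (R : FinRing n) (U S : Subset n) →
    IsUnitSubgroup R U → FinRing.-_ R (FinRing.1# R) ∈ U →
    IsConnectionSet R S → IsUnitary R U S →
    Connected (Cayley R U) →
    Connected (Cayley R S) → AntiConnected (Cayley R S) →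
    (¬ Prime (Cayley R S)) ⇔
      (Σ (Subset n) λ I → IsTwoSidedIdeal R I × NonZeroSet R I × ProperSet R I ×
        Homogeneous (Cayley R S) I)
mainTheorem6 n R U S U-subgroup _ S-connection unitary U-connected connected anticonnected =
  mk⇔ (¬prime⇒homogeneousIdeal U-subgroup S-connection unitary U-connected connected anticonnected)
      homogeneousIdeal⇒¬prime
  where open CayleyGraphs R
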